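{- Let $G=(V,E)$ be a bispanning graph with $E=S\cup T$ for disjoint spanning trees $S,T$, let $G'=(V',E')\subseteq G$ be a subgraph which is itself bispanning, and $\overline E=E\setminus E'$. (i) If $e\in S\cap E'$, then $C_G(T,e)\subseteq (T\cap E')+e$. (ii) If $e\in S\cap\overline E$, then $D_G(S,e)\subseteq (T\cap\overline E)+e$. The same holds with the roles of $S$ and $T$ interchanged.
   Context: Graphs are finite, undirected, may have parallel edges, no loops. A graph is bispanning if its edge set is the disjoint union of two spanning trees. For a spanning tree $T$ and $e\notin T$, $C_G(T,e)$ is the unique cycle (edge set) in $T+e$; for a spanning tree $S$ and $e\in S$, $D_G(S,e)$ is the set of edges of $G$ joining the two components of $S-e$ (including $e$). -}

module Defs where

open import Data.Nat using (ℕ; suc; _≤_)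
open import Data.Fin using (Fin)
open import Data.Product using (Σ; _×_; _,_; proj₁; proj₂)
open import Data.Sum using (_⊎_)
open import Data.List using (List; []; _∷_; length)
open import Data.List.Relation.Unary.Unique.Propositional using (Unique)
open import Data.List.Membership.Propositional using (_∈_)
open import Data.Empty using (⊥)
open import Relation.Nullary using (¬_)
open import Relation.Binary.PropositionalEquality using (_≡_; _≢_)

-- A finite multigraph without loops: vertices Fin n, edges Fin m,
-- each edge has an (ordered, but used unordered) pair of distinct endpoints.
record Graph : Set where
  field
    n        : ℕ
    m        : ℕ
    ends     : Fin m → Fin n × Fin n
    loopless : ∀ f → proj₁ (ends f) ≢ proj₂ (ends f)

open Graph public

VSet : Graph → Set₁
VSet G = Fin (n G) → Set

ESet : Graph → Set₁
ESet G = Fin (m G) → Set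

module _ (G : Graph) where

  Joins : Fin (m G) → Fin (n G) → Fin (n G) → Set
  Joins f u w = (ends G f ≡ (u , w)) ⊎ (ends G f ≡ (w , u))

  data Walk (F : ESet G) : Fin (n G) → Fin (n G) → Set where
    []   : ∀ {u} → Walk F u u
    step : ∀ {u w v} (f : Fin (m G)) → F f → Joins f u w → Walk F w v → Walk F u v

  walkEdges : ∀ {F u v} → Walk F u v → List (Fin (m G))
  walkEdges []             = []
  walkEdges (step f _ _ w) = f ∷ walkEdges w

  -- the vertices from which each step departs (for a closed walk: each vertex once)
  walkStarts : ∀ {F u v} → Walk F u v → List (Fin (n G))
  walkStarts {u = u} []    = []
  walkStarts {u = u} (step f _ _ w) = u ∷ walkStarts w

  IsCycle : ∀ {F u} → Walk F u u → Set
  IsCycle w = (1 ≤ length (walkEdges w)) × Unique (walkEdges w) × Unique (walkStarts w)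

  Acyclic : ESet G → Set
  Acyclic F = ∀ u (w : Walk F u u) → IsCycle w → ⊥

  IsSpanningTreeOf : VSet G → ESet G → ESet G → Set
  IsSpanningTreeOf V' E' F =
    (∀ f → F f → E' f) × Acyclic F × (∀ u v → V' u → V' v → Walk F u v)

  IsSubgraph : VSet G → ESet G → Set
  IsSubgraph V' E' = ∀ f → E' f → V' (proj₁ (ends G f)) × V' (proj₂ (ends G f))

  DisjointUnion : ESet G → ESet G → ESet G → Set
  DisjointUnion E' A B = (∀ f → E' f → A f ⊎ B f) × (∀ f → A f ⊎ B f → E' f)
                         × (∀ f → A f → B f → ⊥)

  IsBispanning : VSet G → ESet G → Set₁
  IsBispanning V' E' = Σ (ESet G) λ A → Σ (ESet G) λ B →
    IsSpanningTreeOf V' E' A × IsSpanningTreeOf V' E' B × DisjointUnion E' A B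

  AllV : VSet G
  AllV _ = Data.Unit.⊤
    where import Data.Unit

  AllE : ESet G
  AllE _ = Data.Unit.⊤
    where import Data.Unit

  plus : ESet G → Fin (m G) → ESet G
  plus F e f = F f ⊎ f ≡ e

  minus : ESet G → Fin (m G) → ESet G
  minus F e f = F f × f ≢ e

  -- C ⊆ X where C ranges over the cycles contained in T + e
  -- (for a spanning tree T and e ∉ T this is exactly C_G(T,e))
  CycleSubset : ESet G → Fin (m G) → ESet G → Set
  CycleSubset T e X = ∀ u (w : Walk (plus T e) u u) → IsCycle w →
                      ∀ f → f ∈ walkEdges w → X f

  -- f ∈ D_G(S,e): f joins the two components of S - e, i.e. one endpoint
  -- is connected (in S - e) to one endpoint of e and the other to the other.
  InCut : ESet G → Fin (m G) → Fin (m G) → Set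
  InCut S e f =
    (Walk (minus S e) (proj₁ (ends G f)) (proj₁ (ends G e)) ×
     Walk (minus S e) (proj₂ (ends G f)) (proj₂ (ends G e)))
    ⊎
    (Walk (minus S e) (proj₁ (ends G f)) (proj₂ (ends G e)) ×
     Walk (minus S e) (proj₂ (ends G f)) (proj₁ (ends G e)))

  CutSubset : ESet G → Fin (m G) → ESet G → Set
  CutSubset S e X = ∀ f → InCut S e f → X f

  Claims : ESet G → ESet G → ESet G → Set
  Claims E' S T =
    (∀ e → S e → E' e →
       CycleSubset T e (λ f → (T f × E' f) ⊎ f ≡ e))
    ×
    (∀ e → S e → ¬ E' e →
       CutSubset S e (λ f → (T f × ¬ E' f) ⊎ f ≡ e))

module Submission where

-- Let a, b be vertices of G′. Saturation yields a finite set X ⊆ V′ containing b such that,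
-- rooting the spanning trees A and B of G′ at a, the parent edges L of the vertices of
-- X ∖ {a} have both ends in X. As A and B are disjoint, |L| ≥ 2 (|X| − 1). The forest S ∩ L
-- on X has at most |X| − 1 edges, and the forest T ∩ L at most |X| − 2 if it does not
-- connect a and b; hence T ∩ L ⊆ T ∩ E′ connects a and b. For e ∈ E′ the cycle of T + e
-- therefore lies in the (T ∩ E′)-path between the ends of e plus e, which is (i).
-- For (ii), an edge f ≠ e of D_G(S,e) lies in T, and e lies on C_G(S,f); if f were in E′,
-- then (i) with S and T exchanged would put e in E′.

open import Defs
open import Data.Bool using (Bool; true; false; if_then_else_)
import Data.Bool.Properties as Bool
open import Data.Empty using (⊥; ⊥-elim)
open import Data.Fin using (Fin; zero; suc)
open import Data.Fin.Properties using (_≟_; suc-injective; any?; 0≢1+n)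
open import Data.List using (List; []; _∷_; _++_; length)
open import Data.List.Properties using (length-++)
open import Data.List.Membership.Propositional using (_∈_; _∉_)
open import Data.List.Membership.Propositional.Properties using (∈-++⁺ˡ)
open import Data.List.Relation.Unary.Any using (here; there)
import Data.List.Relation.Unary.Any as Any
import Data.List.Relation.Unary.All as All
open import Data.List.Relation.Unary.All.Properties using (¬Any⇒All¬; All¬⇒¬Any)
open import Data.List.Relation.Unary.AllPairs using ([]; _∷_)
open import Data.List.Relation.Unary.Unique.Propositional using (Unique)
import Data.List.Relation.Unary.Unique.Propositional.Properties as Unique
open import Data.Maybe as Maybe using (Maybe; just; nothing; is-just; _>>=_)
import Data.Maybe.Properties as Maybeₚ
open import Data.Nat using (ℕ; zero; suc; _≤_; _<_; _+_; z≤n; s≤s)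
open import Data.Nat.Properties
  using (m≤n⇒m≤1+n; +-suc; +-comm; +-identityʳ; m≤n+m; 1+n≰n; <-irrefl; +-mono-≤; +-mono-≤-<;
         module ≤-Reasoning)
open import Data.Product as Product using (Σ; ∃; ∃₂; _×_; _,_; proj₁; proj₂)
open import Data.Sum as Sum using (_⊎_; inj₁; inj₂; [_,_])
open import Data.Unit using (tt)
open import Function using (id; _∘_)
open import Level using (0ℓ)
open import Relation.Nullary using (¬_; yes; no; ¬?)
open import Relation.Nullary.Decidable using (_×-dec_; _⊎-dec_; decidable-stable)
open import Relation.Unary using (Pred; Decidable; _⊆_; _∪_; _∩_)
open import Relation.Unary.Properties using (_∩?_)
open import Relation.Binary.PropositionalEquality hiding ([_])

true≢false : true ≢ false
true≢false ()

private variable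
  k : ℕ
  P Q U : Pred (Fin k) 0ℓ

count : Decidable P → ℕ
count {zero}  P? = 0
count {suc k} P? with P? zero
... | yes _ = suc (count (P? ∘ suc))
... | no _  = count (P? ∘ suc)

_∖?_ : Decidable P → (y : Fin k) → Decidable (λ z → P z × z ≢ y)
(P? ∖? y) z = P? z ×-dec ¬? (z ≟ y)

count-≤ : ∀ {k} {P : Pred (Fin k) 0ℓ} (P? : Decidable P) → count P? ≤ k
count-≤ {zero}  P? = z≤n
count-≤ {suc k} P? with P? zero
... | yes _ = s≤s (count-≤ (P? ∘ suc))
... | no _  = m≤n⇒m≤1+n (count-≤ (P? ∘ suc))

count-cong : (P? : Decidable P) (Q? : Decidable Q) → P ⊆ Q → Q ⊆ P → count P? ≡ count Q?
count-cong {zero}  P? Q? P⊆Q Q⊆P = refl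
count-cong {suc k} P? Q? P⊆Q Q⊆P
  with P? zero | Q? zero | count-cong (P? ∘ suc) (Q? ∘ suc) P⊆Q Q⊆P
... | yes _ | yes _ | tails-eq = cong suc tails-eq
... | no _  | no _  | tails-eq = tails-eq
... | yes p | no ¬q | _        = ⊥-elim (¬q (P⊆Q p))
... | no ¬p | yes q | _        = ⊥-elim (¬p (Q⊆P q))

count-remove : (P? : Decidable P) {y : Fin k} → P y → count P? ≡ suc (count (P? ∖? y))
count-remove {suc k} P? {zero} py with P? zero | (P? ∖? zero) zero
... | no ¬p | _             = ⊥-elim (¬p py)
... | yes _ | yes (_ , 0≢0) = ⊥-elim (0≢0 refl)
... | yes _ | no _          =
  cong suc (count-cong (P? ∘ suc) ((P? ∖? zero) ∘ suc) (_, 0≢1+n ∘ sym) proj₁)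
count-remove {suc k} P? {suc y} py
  with P? zero | (P? ∖? suc y) zero
     | trans (count-remove (P? ∘ suc) py)
             (cong suc (count-cong ((P? ∘ suc) ∖? y) ((P? ∖? suc y) ∘ suc)
               (Product.map₂ (_∘ suc-injective)) (Product.map₂ (_∘ cong suc))))
... | yes p | no ¬p′      | _        = ⊥-elim (¬p′ (p , 0≢1+n))
... | no ¬p | yes (p , _) | _        = ⊥-elim (¬p p)
... | yes _ | yes _       | tails-eq = cong suc tails-eq
... | no _  | no _        | tails-eq = tails-eq

count-injection : ∀ {a b} {P : Pred (Fin a) 0ℓ} {Q : Pred (Fin b) 0ℓ}
                  (P? : Decidable P) (Q? : Decidable Q) (f : ∀ x → P x → Fin b) →
                  (∀ x px → Q (f x px)) → (∀ {x y} px py → f x px ≡ f y py → x ≡ y) →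
                  count P? ≤ count Q?
count-injection {zero}  P? Q? f f∈Q f-inj = z≤n
count-injection {suc a} P? Q? f f∈Q f-inj with P? zero
... | no _   = count-injection (P? ∘ suc) Q? (f ∘ suc) (f∈Q ∘ suc) (λ px py → suc-injective ∘ f-inj px py)
... | yes p₀ = subst (suc (count (P? ∘ suc)) ≤_) (sym (count-remove Q? (f∈Q zero p₀)))
                 (s≤s (count-injection (P? ∘ suc) (Q? ∖? f zero p₀) (f ∘ suc)
                   (λ x px → f∈Q (suc x) px , 0≢1+n ∘ f-inj p₀ px ∘ sym)
                   (λ px py → suc-injective ∘ f-inj px py)))

count-⊎ : (P? : Decidable P) (Q? : Decidable Q) (U? : Decidable U) →
          U ⊆ P ∪ Q → P ∪ Q ⊆ U → (∀ {x} → P x → Q x → ⊥) → count U? ≡ count P? + count Q?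
count-⊎ {zero}  P? Q? U? U⊆P∪Q P∪Q⊆U disjoint = refl
count-⊎ {suc k} P? Q? U? U⊆P∪Q P∪Q⊆U disjoint
  with P? zero | Q? zero | U? zero | count-⊎ (P? ∘ suc) (Q? ∘ suc) (U? ∘ suc) U⊆P∪Q P∪Q⊆U disjoint
... | yes p | yes q | _     | _        = ⊥-elim (disjoint p q)
... | yes p | no _  | no ¬u | _        = ⊥-elim (¬u (P∪Q⊆U (inj₁ p)))
... | no _  | yes q | no ¬u | _        = ⊥-elim (¬u (P∪Q⊆U (inj₂ q)))
... | no ¬p | no ¬q | yes u | _        = ⊥-elim ([ ¬p , ¬q ] (U⊆P∪Q u))
... | yes _ | no _  | yes _ | tails-eq = cong suc tails-eq
... | no _  | yes _ | yes _ | tails-eq = trans (cong suc tails-eq) (sym (+-suc _ _))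
... | no _  | no _  | no _  | tails-eq = tails-eq

module Saturation {k : ℕ} (I : Fin k → Set) where

  PartialSection : Set
  PartialSection = (z : Fin k) → Maybe (I z)

  Defined : PartialSection → Pred (Fin k) 0ℓ
  Defined W z = is-just (W z) ≡ true

  defined? : (W : PartialSection) → Decidable (Defined W)
  defined? W z = is-just (W z) Bool.≟ true

  insert : PartialSection → (z : Fin k) → I z → PartialSection
  insert W z i y with y ≟ z
  ... | yes refl = just i
  ... | no _     = W y

  insert-≢ : ∀ W {z} i {y} → y ≢ z → insert W z i y ≡ W y
  insert-≢ W {z} i {y} y≢z with y ≟ z
  ... | yes y≡z = ⊥-elim (y≢z y≡z)
  ... | no _    = refl

  insert-defined : ∀ W z i → Defined (insert W z i) z
  insert-defined W z i with z ≟ z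
  ... | yes refl = refl
  ... | no z≢z   = ⊥-elim (z≢z refl)

  insert-extends : ∀ W z i → Defined W ⊆ Defined (insert W z i)
  insert-extends W z i {y} d with y ≟ z
  ... | yes refl = refl
  ... | no _     = d

  defined⇒just : ∀ W {z} → Defined W z → ∃ λ i → W z ≡ just i
  defined⇒just W {z} d with W z
  ... | just i  = i , refl
  ... | nothing = ⊥-elim (true≢false (sym d))

  undefined⇒nothing : ∀ W {z} → ¬ Defined W z → W z ≡ nothing
  undefined⇒nothing W {z} ¬d with W z
  ... | just _  = ⊥-elim (¬d refl)
  ... | nothing = refl

  count-insert : ∀ W {z} i → W z ≡ nothing → count (defined? (insert W z i)) ≡ suc (count (defined? W))
  count-insert W {z} i Wz≡nothing =
    trans (count-remove (defined? (insert W z i)) (insert-defined W z i))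
          (cong suc (count-cong (defined? (insert W z i) ∖? z) (defined? W)
            (λ (d , y≢z) → trans (cong is-just (sym (insert-≢ W i y≢z))) d)
            (λ d → trans (cong is-just (insert-≢ W i (≢z d))) d , ≢z d)))
    where ≢z : ∀ {y} → Defined W y → y ≢ z
          ≢z d refl = true≢false (trans (sym d) (cong is-just Wz≡nothing))

  module _ (Closed : PartialSection → Set)
           (grow : ∀ W → Closed W ⊎ ∃ λ z → W z ≡ nothing × I z) where

    saturate-with : (fuel : ℕ) (W : PartialSection) → k ≤ count (defined? W) + fuel →
                    ∃ λ W′ → Defined W ⊆ Defined W′ × Closed W′
    saturate-with fuel W room with grow W
    ... | inj₁ closed = W , id , closed
    ... | inj₂ (z , Wz≡nothing , i) with fuel | count-insert W i Wz≡nothing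
    ...   | zero | grown = ⊥-elim (1+n≰n (begin
      suc (count (defined? W))          ≡⟨ grown ⟨
      count (defined? (insert W z i))   ≤⟨ count-≤ (defined? (insert W z i)) ⟩
      k                                 ≤⟨ room ⟩
      count (defined? W) + 0            ≡⟨ +-identityʳ _ ⟩
      count (defined? W)                ∎))
      where open ≤-Reasoning
    ...   | suc fuel | grown
      with saturate-with fuel (insert W z i)
             (subst (λ c → k ≤ c + fuel) (sym grown) (subst (k ≤_) (+-suc _ fuel) room))
    ...     | W′ , W⊆W′ , closed = W′ , W⊆W′ ∘ insert-extends W z i , closed

    saturate : (W : PartialSection) → ∃ λ W′ → Defined W ⊆ Defined W′ × Closed W′
    saturate W = saturate-with k W (m≤n+m k _)

module Walks (G : Graph) where

  Vertex = Fin (n G)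
  Edge   = Fin (m G)

  end₁ end₂ : Edge → Vertex
  end₁ f = proj₁ (ends G f)
  end₂ f = proj₂ (ends G f)

  _─_ : ESet G → Edge → ESet G
  F ─ f = minus G F f

  private variable
    F F′ : ESet G
    f g : Edge
    u v w x y : Vertex

  joins-sym : Joins G f u v → Joins G f v u
  joins-sym (inj₁ eq) = inj₂ eq
  joins-sym (inj₂ eq) = inj₁ eq

  joins-start : Joins G f u v → Joins G f x y → u ≡ x ⊎ u ≡ y
  joins-start (inj₁ a) (inj₁ b) = inj₁ (cong proj₁ (trans (sym a) b))
  joins-start (inj₁ a) (inj₂ b) = inj₂ (cong proj₁ (trans (sym a) b))
  joins-start (inj₂ a) (inj₁ b) = inj₂ (cong proj₂ (trans (sym a) b))
  joins-start (inj₂ a) (inj₂ b) = inj₁ (cong proj₂ (trans (sym a) b))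

  joins-flip : Joins G f u v → Joins G f x y → u ≢ x → x ≡ v × y ≡ u
  joins-flip (inj₁ a) (inj₁ b) u≢x = ⊥-elim (u≢x (cong proj₁ (trans (sym a) b)))
  joins-flip (inj₁ a) (inj₂ b) u≢x = cong proj₂ (trans (sym b) a) , cong proj₁ (trans (sym b) a)
  joins-flip (inj₂ a) (inj₁ b) u≢x = cong proj₁ (trans (sym b) a) , cong proj₂ (trans (sym b) a)
  joins-flip (inj₂ a) (inj₂ b) u≢x = ⊥-elim (u≢x (cong proj₂ (trans (sym a) b)))

  edgesOf : Walk G F u v → List Edge
  edgesOf = walkEdges G

  verticesOf : Walk G F u v → List Vertex
  verticesOf {u = u} []             = u ∷ []
  verticesOf {u = u} (step _ _ _ p) = u ∷ verticesOf p

  IsPath : Walk G F u v → Set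
  IsPath p = Unique (verticesOf p)

  _++ʷ_ : Walk G F u v → Walk G F v w → Walk G F u w
  []              ++ʷ q = q
  step f Ff j p ++ʷ q = step f Ff j (p ++ʷ q)

  reverseʷ : Walk G F u v → Walk G F v u
  reverseʷ []              = []
  reverseʷ (step f Ff j p) = reverseʷ p ++ʷ step f Ff (joins-sym j) []

  mapʷ : F ⊆ F′ → Walk G F u v → Walk G F′ u v
  mapʷ F⊆F′ []              = []
  mapʷ F⊆F′ (step f Ff j p) = step f (F⊆F′ Ff) j (mapʷ F⊆F′ p)

  edge-on-walk : (p : Walk G F u v) → f ∈ edgesOf p → F f
  edge-on-walk (step f Ff j p) (here refl) = Ff
  edge-on-walk (step f Ff j p) (there i)   = edge-on-walk p i

  avoiding : (p : Walk G F u v) → f ∉ edgesOf p → Walk G (F ─ f) u v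
  avoiding []              _   = []
  avoiding (step g Fg j p) f∉p = step g (Fg , λ g≡f → f∉p (here (sym g≡f))) j (avoiding p (f∉p ∘ there))

  start-on-walk : (p : Walk G F u v) → u ∈ verticesOf p
  start-on-walk []             = here refl
  start-on-walk (step _ _ _ _) = here refl

  end-on-walk : (p : Walk G F u v) → v ∈ verticesOf p
  end-on-walk []             = here refl
  end-on-walk (step _ _ _ p) = there (end-on-walk p)

  edgesOf-++ : (p : Walk G F u v) (q : Walk G F v w) → edgesOf (p ++ʷ q) ≡ edgesOf p ++ edgesOf q
  edgesOf-++ []             q = refl
  edgesOf-++ (step f _ _ p) q = cong (f ∷_) (edgesOf-++ p q)

  edgesOf-map : (F⊆F′ : F ⊆ F′) (p : Walk G F u v) → edgesOf (mapʷ F⊆F′ p) ≡ edgesOf p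
  edgesOf-map F⊆F′ []             = refl
  edgesOf-map F⊆F′ (step f _ _ p) = cong (f ∷_) (edgesOf-map F⊆F′ p)

  verticesOf-map : (F⊆F′ : F ⊆ F′) (p : Walk G F u v) → verticesOf (mapʷ F⊆F′ p) ≡ verticesOf p
  verticesOf-map F⊆F′ []                     = refl
  verticesOf-map F⊆F′ (step {u = u} _ _ _ p) = cong (u ∷_) (verticesOf-map F⊆F′ p)

  walkStarts-++ : (p : Walk G F u v) (q : Walk G F v w) →
                  walkStarts G (p ++ʷ q) ≡ walkStarts G p ++ walkStarts G q
  walkStarts-++ []                     q = refl
  walkStarts-++ (step {u = u} _ _ _ p) q = cong (u ∷_) (walkStarts-++ p q)

  walkStarts-verticesOf : (p : Walk G F u v) → walkStarts G p ++ v ∷ [] ≡ verticesOf p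
  walkStarts-verticesOf []                     = refl
  walkStarts-verticesOf (step {u = u} _ _ _ p) = cong (u ∷_) (walkStarts-verticesOf p)

  suffix-from : (p : Walk G F y v) → x ∈ verticesOf p → IsPath p → Σ (Walk G F x v) IsPath
  suffix-from []               (here refl) p-path       = [] , p-path
  suffix-from p@(step _ _ _ _) (here refl) p-path       = p , p-path
  suffix-from (step _ _ _ p)   (there i)   (_ ∷ p-path) = suffix-from p i p-path

  erase-loops : Walk G F u v → Σ (Walk G F u v) IsPath
  erase-loops []                      = [] , All.[] ∷ []
  erase-loops {u = u} (step f Ff j p) with erase-loops p
  ... | q , q-path with Any.any? (u ≟_) (verticesOf q)
  ...   | yes u∈q = suffix-from q u∈q q-path
  ...   | no  u∉q = step f Ff j q , ¬Any⇒All¬ _ u∉q ∷ q-path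

  incident-edge-off-walk : (p : Walk G F u v) → x ∉ verticesOf p → g ∈ edgesOf p → ¬ Joins G g x y
  incident-edge-off-walk (step h _ jh p) x∉p (here refl) j with joins-start j jh
  ... | inj₁ refl = x∉p (here refl)
  ... | inj₂ refl = x∉p (there (start-on-walk p))
  incident-edge-off-walk (step _ _ _ p) x∉p (there i) j = incident-edge-off-walk p (x∉p ∘ there) i j

  path⇒unique-edges : (p : Walk G F u v) → IsPath p → Unique (edgesOf p)
  path⇒unique-edges []             _              = []
  path⇒unique-edges (step f _ j p) (u∉p ∷ p-path) =
    ¬Any⇒All¬ _ (λ f∈p → incident-edge-off-walk p (All¬⇒¬Any u∉p) f∈p j) ∷
    path⇒unique-edges p p-path

  edgesOf-map-++-step : (F⊆F′ : F ⊆ F′) (p : Walk G F u v) (F′f : F′ f) (j : Joins G f v w) →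
                        edgesOf (mapʷ F⊆F′ p ++ʷ step f F′f j []) ≡ edgesOf p ++ f ∷ []
  edgesOf-map-++-step {f = f} F⊆F′ p F′f j =
    trans (edgesOf-++ (mapʷ F⊆F′ p) _) (cong (_++ f ∷ []) (edgesOf-map F⊆F′ p))

  path+edge-isCycle : (F⊆F′ : F ⊆ F′) (p : Walk G F y x) → IsPath p → f ∉ edgesOf p →
                      (F′f : F′ f) (j : Joins G f x y) → IsCycle G (mapʷ F⊆F′ p ++ʷ step f F′f j [])
  path+edge-isCycle {F′ = F′} {f = f} F⊆F′ p p-path f∉p F′f j = nonempty , unique-edges , unique-starts
    where
      open ≡-Reasoning

      nonempty : 1 ≤ length (edgesOf (mapʷ F⊆F′ p ++ʷ step f F′f j []))
      nonempty rewrite edgesOf-map-++-step F⊆F′ p F′f j | length-++ (edgesOf p) {f ∷ []}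
                     | +-comm (length (edgesOf p)) 1 = s≤s z≤n

      unique-edges : Unique (edgesOf (mapʷ F⊆F′ p ++ʷ step f F′f j []))
      unique-edges rewrite edgesOf-map-++-step F⊆F′ p F′f j =
        Unique.++⁺ (path⇒unique-edges p p-path) (All.[] ∷ []) λ { (f∈p , here refl) → f∉p f∈p }

      unique-starts : Unique (walkStarts G (mapʷ F⊆F′ p ++ʷ step f F′f j []))
      unique-starts = subst Unique (sym (begin
        walkStarts G (mapʷ F⊆F′ p ++ʷ step f F′f j [])
          ≡⟨ walkStarts-++ (mapʷ F⊆F′ p) _ ⟩
        walkStarts G (mapʷ F⊆F′ p) ++ walkStarts G {F′} (step f F′f j [])
          ≡⟨ walkStarts-verticesOf (mapʷ F⊆F′ p) ⟩
        verticesOf (mapʷ F⊆F′ p)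
          ≡⟨ verticesOf-map F⊆F′ p ⟩
        verticesOf p ∎)) p-path

  acyclic⇒bridge : Acyclic G F → F f → Joins G f x y → ¬ Walk G (F ─ f) y x
  acyclic⇒bridge acyclic Ff j detour with erase-loops detour
  ... | p , p-path =
    acyclic _ _ (path+edge-isCycle proj₁ p p-path (λ f∈p → proj₂ (edge-on-walk p f∈p) refl) Ff j)

  split-at : (p : Walk G F u v) → Unique (edgesOf p) → f ∈ edgesOf p →
             ∃₂ λ x y → Joins G f x y × Walk G (F ─ f) u x × Walk G (F ─ f) y v
  split-at (step g Fg j p) (g∉p ∷ _)        (here refl) = _ , _ , j , [] , avoiding p (All¬⇒¬Any g∉p)
  split-at (step g Fg j p) (g∉p ∷ p-unique) (there i) with split-at p p-unique i
  ... | x , y , jf , before , after = x , y , jf , step g (Fg , All.lookup g∉p i) j before , after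

  -- An edge of the cycle off p could be bypassed through p, which acyclic⇒bridge forbids.
  fundamentalCycle⊆path+edge : ∀ {e} → Acyclic G F → F′ ⊆ F → Walk G F′ (end₁ e) (end₂ e) →
                               CycleSubset G F e (λ f → F′ f ⊎ f ≡ e)
  fundamentalCycle⊆path+edge {F} {F′} {e} acyclic F′⊆F p _ c (_ , c-unique , _) f f∈c
    with edge-on-walk c f∈c
  ... | inj₂ f≡e = inj₂ f≡e
  ... | inj₁ Ff with Any.any? (f ≟_) (edgesOf p)
  ...   | yes f∈p = inj₁ (edge-on-walk p f∈p)
  ...   | no  f∉p with split-at c c-unique f∈c
  ...     | _ , _ , j , before , after = ⊥-elim (acyclic⇒bridge acyclic Ff j (bypass (after ++ʷ before)))
    where
      p′ : Walk G (F ─ f) (end₁ e) (end₂ e)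
      p′ = mapʷ (Product.map₁ F′⊆F) (avoiding p f∉p)

      across-e : ∀ {s t} → Joins G e s t → Walk G (F ─ f) s t
      across-e (inj₁ eq) = subst₂ (Walk G (F ─ f)) (cong proj₁ eq) (cong proj₂ eq) p′
      across-e (inj₂ eq) = subst₂ (Walk G (F ─ f)) (cong proj₂ eq) (cong proj₁ eq) (reverseʷ p′)

      bypass : ∀ {s t} → Walk G (plus G F e ─ f) s t → Walk G (F ─ f) s t
      bypass []                              = []
      bypass (step g (inj₁ Fg , g≢f) j rest) = step g (Fg , g≢f) j (bypass rest)
      bypass (step g (inj₂ refl , _) j rest) = across-e j ++ʷ bypass rest

  cut-bridge : ∀ {e} → Acyclic G F → F e → InCut G F e f → ¬ Walk G (F ─ e) (end₂ f) (end₁ f)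
  cut-bridge acyclic Fe (inj₁ (w₁ , w₂)) q =
    acyclic⇒bridge acyclic Fe (inj₁ refl) (reverseʷ w₂ ++ʷ (q ++ʷ w₁))
  cut-bridge acyclic Fe (inj₂ (w₁ , w₂)) q =
    acyclic⇒bridge acyclic Fe (inj₁ refl) (reverseʷ w₁ ++ʷ (reverseʷ q ++ʷ w₂))

  cut∩tree : ∀ {e} → Acyclic G F → F e → InCut G F e f → F f → f ≡ e
  cut∩tree {f = f} {e} acyclic Fe f∈cut Ff with f ≟ e
  ... | yes f≡e = f≡e
  ... | no  f≢e = ⊥-elim (cut-bridge acyclic Fe f∈cut (step f (Ff , f≢e) (inj₂ refl) []))

  cut-edge⇒on-cycle : ∀ {e X} → Acyclic G F → F e → Walk G F (end₂ f) (end₁ f) →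
                      InCut G F e f → ¬ F f → CycleSubset G F f X → X e
  cut-edge⇒on-cycle {e = e} acyclic Fe walk f∈cut ¬Ff cycle⊆X with erase-loops walk
  ... | p , p-path with Any.any? (e ≟_) (edgesOf p)
  ...   | no  e∉p = ⊥-elim (cut-bridge acyclic Fe f∈cut (avoiding p e∉p))
  ...   | yes e∈p =
    cycle⊆X _ _ (path+edge-isCycle inj₁ p p-path (¬Ff ∘ edge-on-walk p) (inj₂ refl) (inj₁ refl)) e
      (subst (e ∈_) (sym (edgesOf-map-++-step inj₁ p (inj₂ refl) (inj₁ refl))) (∈-++⁺ˡ e∈p))

  firstEdge : Walk G F u v → Maybe Edge
  firstEdge []             = nothing
  firstEdge (step f _ _ _) = just f

  firstEdge-nothing : (p : Walk G F u v) → firstEdge p ≡ nothing → u ≡ v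
  firstEdge-nothing [] _ = refl

  path-firstStep : (p : Walk G F u v) → IsPath p → firstEdge p ≡ just f →
                   F f × u ≢ v × ∃ λ y → Joins G f u y × Walk G (F ─ f) y v
  path-firstStep (step f Ff j p) (u∉p ∷ _) refl =
    Ff , (λ { refl → All¬⇒¬Any u∉p (end-on-walk p) }) ,
    _ , j , avoiding p (λ f∈p → incident-edge-off-walk p (All¬⇒¬Any u∉p) f∈p j)

  incident-edge-off-path : (p : Walk G F u v) → IsPath p → Joins G g u y → firstEdge p ≢ just g →
                           g ∉ edgesOf p
  incident-edge-off-path (step _ _ _ _) _         _ first≢g (here refl) = first≢g refl
  incident-edge-off-path (step _ _ _ p) (u∉p ∷ _) j _       (there g∈p) =
    incident-edge-off-walk p (All¬⇒¬Any u∉p) g∈p j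

  module Rooted {F : ESet G} (acyclic : Acyclic G F) (r : Vertex)
                (route : (z : Vertex) → Maybe (Walk G F z r)) where

    parentEdge : Vertex → Maybe Edge
    parentEdge z = route z >>= firstEdge ∘ proj₁ ∘ erase-loops

    parent-step : parentEdge u ≡ just f → F f × u ≢ r × ∃ λ y → Joins G f u y × Walk G (F ─ f) y r
    parent-step {u} eq with route u
    ... | just w with erase-loops w
    ...   | p , p-path = path-firstStep p p-path eq

    parent-defined : ∀ {w} → route u ≡ just w → u ≢ r → ∃ λ f → parentEdge u ≡ just f
    parent-defined {u} {w} eq u≢r rewrite eq with erase-loops w
    ... | p , _ with firstEdge p in first
    ...   | just f  = f , refl
    ...   | nothing = ⊥-elim (u≢r (firstEdge-nothing p first))

    route-avoids : ∀ {w} → route u ≡ just w → Joins G g u y → parentEdge u ≢ just g → Walk G (F ─ g) u r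
    route-avoids {w = w} eq j parent≢g rewrite eq with erase-loops w
    ... | p , p-path = avoiding p (incident-edge-off-path p p-path j parent≢g)

    -- Vertices with the same parent edge f would be its two ends, both reaching r without f.
    parent-injective : parentEdge u ≡ just f → parentEdge v ≡ just f → u ≡ v
    parent-injective {u} {f} {v} eq eq′ with u ≟ v
    ... | yes u≡v = u≡v
    ... | no u≢v with parent-step eq | parent-step eq′
    ...   | Ff , _ , _ , j , rest | _ , _ , _ , j′ , rest′ with joins-flip j j′ u≢v
    ...     | refl , refl = ⊥-elim (acyclic⇒bridge acyclic Ff j (rest ++ʷ reverseʷ rest′))

    parent-covers : F f → ∀ {w₁ w₂} → route (end₁ f) ≡ just w₁ → route (end₂ f) ≡ just w₂ →
                    parentEdge (end₁ f) ≡ just f ⊎ parentEdge (end₂ f) ≡ just f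
    parent-covers {f} Ff eq₁ eq₂
      with Maybeₚ.≡-dec _≟_ (parentEdge (end₁ f)) (just f)
         | Maybeₚ.≡-dec _≟_ (parentEdge (end₂ f)) (just f)
    ... | yes p₁ | _      = inj₁ p₁
    ... | no _   | yes p₂ = inj₂ p₂
    ... | no ¬p₁ | no ¬p₂ = ⊥-elim (acyclic⇒bridge acyclic Ff (inj₁ refl)
          (route-avoids eq₂ (inj₂ refl) ¬p₂ ++ʷ reverseʷ (route-avoids eq₁ (inj₁ refl) ¬p₁)))

    IsParentEdge : ESet G
    IsParentEdge f = ∃ λ z → parentEdge z ≡ just f

    parentEdge? : Decidable IsParentEdge
    parentEdge? f = any? λ z → Maybeₚ.≡-dec _≟_ (parentEdge z) (just f)

    parentEdges-lowerBound : ∀ {Z} (Z? : Decidable Z) →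
                             (∀ {z} → Z z → z ≢ r × ∃ λ w → route z ≡ just w) →
                             count Z? ≤ count parentEdge?
    parentEdges-lowerBound {Z} Z? routed =
      count-injection Z? parentEdge? (λ _ Zz → proj₁ (parent-of Zz)) (λ z Zz → z , proj₂ (parent-of Zz))
        λ Zz Zz′ eq → parent-injective (proj₂ (parent-of Zz))
                        (subst (λ f → parentEdge _ ≡ just f) (sym eq) (proj₂ (parent-of Zz′)))
      where parent-of : ∀ {z} → Z z → ∃ λ f → parentEdge z ≡ just f
            parent-of Zz = parent-defined (proj₂ (proj₂ (routed Zz))) (proj₁ (routed Zz))

  module RootedTree {F : ESet G} (acyclic : Acyclic G F) (r : Vertex) (path : (z : Vertex) → Walk G F z r) where
    open Rooted acyclic r (just ∘ path)

    -- Every edge of F is the parent edge of exactly one of its ends, its child.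
    child : Edge → Vertex
    child g with Maybeₚ.≡-dec _≟_ (parentEdge (end₁ g)) (just g)
    ... | yes _ = end₁ g
    ... | no _  = end₂ g

    child-end : ∀ g → child g ≡ end₁ g ⊎ child g ≡ end₂ g
    child-end g with Maybeₚ.≡-dec _≟_ (parentEdge (end₁ g)) (just g)
    ... | yes _ = inj₁ refl
    ... | no _  = inj₂ refl

    child-parent : F g → parentEdge (child g) ≡ just g
    child-parent {g} Fg with Maybeₚ.≡-dec _≟_ (parentEdge (end₁ g)) (just g)
    ... | yes p₁ = p₁
    ... | no ¬p₁ = [ ⊥-elim ∘ ¬p₁ , id ] (parent-covers Fg refl refl)

    child-≢-root : F g → child g ≢ r
    child-≢-root Fg = proj₁ (proj₂ (parent-step (child-parent Fg)))

    child-injective : F g → F f → child g ≡ child f → g ≡ f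
    child-injective Fg Ff eq =
      Maybeₚ.just-injective (trans (sym (child-parent Fg)) (trans (cong parentEdge eq) (child-parent Ff)))

  module SpanningTree {F : ESet G} (acyclic : Acyclic G F) (connected : ∀ u v → Walk G F u v) where

    module Root (r : Vertex) = RootedTree acyclic r (λ z → connected z r)

    module _ {Y : ESet G} {Z : Pred Vertex 0ℓ} (Y? : Decidable Y) (Z? : Decidable Z)
             (Y⊆F : Y ⊆ F) (ends∈Z : ∀ {g} → Y g → Z (end₁ g) × Z (end₂ g)) where

      child∈Z : ∀ r {g} → Y g → Z (Root.child r g)
      child∈Z r {g} Yg with Root.child-end r g
      ... | inj₁ eq = subst Z (sym eq) (proj₁ (ends∈Z Yg))
      ... | inj₂ eq = subst Z (sym eq) (proj₂ (ends∈Z Yg))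

      edges-upperBound : ∀ r → count Y? ≤ count (Z? ∖? r)
      edges-upperBound r =
        count-injection Y? (Z? ∖? r) (λ g _ → Root.child r g)
          (λ g Yg → child∈Z r Yg , Root.child-≢-root r (Y⊆F Yg))
          (λ Yg Yg′ → Root.child-injective r (Y⊆F Yg) (Y⊆F Yg′))

      -- Edges on a's side are counted by their children towards a, the others by their
      -- children towards b; neither root is hit.
      module _ (side : Vertex → Bool) (same-side : ∀ {g} → Y g → side (end₁ g) ≡ side (end₂ g))
               {a b : Vertex} (side-a : side a ≡ true) (side-b : side b ≡ false) where

        side-child : ∀ r {g} → Y g → side (Root.child r g) ≡ side (end₁ g)
        side-child r {g} Yg with Root.child-end r g
        ... | inj₁ eq = cong side eq
        ... | inj₂ eq = trans (cong side eq) (sym (same-side Yg))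

        childOnSide : Edge → Vertex
        childOnSide g = if side (end₁ g) then Root.child a g else Root.child b g

        childOnSide-∈ : ∀ {g} → Y g → (Z (childOnSide g) × childOnSide g ≢ a) × childOnSide g ≢ b
        childOnSide-∈ {g} Yg with side (end₁ g) in s
        ... | true  =
          (child∈Z a Yg , Root.child-≢-root a (Y⊆F Yg)) ,
          λ c≡b → true≢false (trans (sym (trans (side-child a Yg) s)) (trans (cong side c≡b) side-b))
        ... | false =
          (child∈Z b Yg ,
           λ c≡a → true≢false (trans (sym side-a) (trans (cong side (sym c≡a)) (trans (side-child b Yg) s)))) ,
          Root.child-≢-root b (Y⊆F Yg)

        childOnSide-injective : ∀ {g g′} → Y g → Y g′ → childOnSide g ≡ childOnSide g′ → g ≡ g′
        childOnSide-injective {g} {g′} Yg Yg′ eq with side (end₁ g) in s | side (end₁ g′) in s′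
        ... | true  | true  = Root.child-injective a (Y⊆F Yg) (Y⊆F Yg′) eq
        ... | false | false = Root.child-injective b (Y⊆F Yg) (Y⊆F Yg′) eq
        ... | true  | false = ⊥-elim (true≢false (trans (sym (trans (side-child a Yg) s))
                                (trans (cong side eq) (trans (side-child b Yg′) s′))))
        ... | false | true  = ⊥-elim (true≢false (trans (sym (trans (side-child a Yg′) s′))
                                (trans (cong side (sym eq)) (trans (side-child b Yg) s))))

        edges-upperBound-separated : count Y? ≤ count ((Z? ∖? a) ∖? b)
        edges-upperBound-separated =
          count-injection Y? ((Z? ∖? a) ∖? b) (λ g _ → childOnSide g) (λ _ → childOnSide-∈)
            childOnSide-injective

module BispanningSubgraph (G : Graph) {S T : ESet G}
  (S-tree : IsSpanningTreeOf G (AllV G) (AllE G) S) (T-tree : IsSpanningTreeOf G (AllV G) (AllE G) T)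
  (S⊎T : DisjointUnion G (AllE G) S T)
  {V′ : VSet G} {E′ : ESet G} (subgraph : IsSubgraph G V′ E′) {A B : ESet G}
  (A-tree : IsSpanningTreeOf G V′ E′ A) (B-tree : IsSpanningTreeOf G V′ E′ B) (A⊎B : DisjointUnion G E′ A B)
  where

  open Walks G

  S? : Decidable S
  S? f with proj₁ S⊎T f tt
  ... | inj₁ Sf = yes Sf
  ... | inj₂ Tf = no λ Sf → proj₂ (proj₂ S⊎T) f Sf Tf

  T? : Decidable T
  T? f with proj₁ S⊎T f tt
  ... | inj₁ Sf = no λ Tf → proj₂ (proj₂ S⊎T) f Sf Tf
  ... | inj₂ Tf = yes Tf

  module TreeS = SpanningTree (proj₁ (proj₂ S-tree)) (λ u v → proj₂ (proj₂ S-tree) u v tt tt)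
  module TreeT = SpanningTree (proj₁ (proj₂ T-tree)) (λ u v → proj₂ (proj₂ T-tree) u v tt tt)

  module _ {a b : Vertex} (V′a : V′ a) (V′b : V′ b) where

    open Saturation V′

    -- V′ is not decidable, so it cannot be counted; the counting happens in a finite set X ⊆ V′,
    -- represented with witnesses of membership in V′ from which routes to a in A and B are built.
    module ParentsIn (W : PartialSection) {P : ESet G} (P-tree : IsSpanningTreeOf G V′ E′ P) =
      Rooted (proj₁ (proj₂ P-tree)) a
        (λ z → Maybe.map (λ V′z → proj₂ (proj₂ P-tree) z a V′z V′a) (W z))

    ParentEdge : PartialSection → ESet G
    ParentEdge W f = ParentsIn.IsParentEdge W A-tree f ⊎ ParentsIn.IsParentEdge W B-tree f

    parentEdge? : ∀ W → Decidable (ParentEdge W)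
    parentEdge? W f = ParentsIn.parentEdge? W A-tree f ⊎-dec ParentsIn.parentEdge? W B-tree f

    parentEdge⊆E′ : ∀ W → ParentEdge W ⊆ E′
    parentEdge⊆E′ W (inj₁ (_ , eq)) = proj₁ A-tree _ (proj₁ (ParentsIn.parent-step W A-tree eq))
    parentEdge⊆E′ W (inj₂ (_ , eq)) = proj₁ B-tree _ (proj₁ (ParentsIn.parent-step W B-tree eq))

    ParentClosed : PartialSection → Set
    ParentClosed W = ∀ {f} → ParentEdge W f → Defined W (end₁ f) × Defined W (end₂ f)

    grow-parentClosed : ∀ W → ParentClosed W ⊎ ∃ λ z → W z ≡ nothing × V′ z
    grow-parentClosed W with any? (λ f → parentEdge? W f ×-dec ¬? (defined? W (end₁ f)))
                           | any? (λ f → parentEdge? W f ×-dec ¬? (defined? W (end₂ f)))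
    ... | yes (f , Pf , ¬d) | _ =
      inj₂ (end₁ f , undefined⇒nothing W ¬d , proj₁ (subgraph f (parentEdge⊆E′ W Pf)))
    ... | no _ | yes (f , Pf , ¬d) =
      inj₂ (end₂ f , undefined⇒nothing W ¬d , proj₂ (subgraph f (parentEdge⊆E′ W Pf)))
    ... | no none₁ | no none₂ = inj₁ λ {f} Pf →
      decidable-stable (defined? W (end₁ f)) (λ ¬d → none₁ (f , Pf , ¬d)) ,
      decidable-stable (defined? W (end₂ f)) (λ ¬d → none₂ (f , Pf , ¬d))

    -- Opaque: only the stated properties of the fixpoint are used, and unfolding it is costly.
    private opaque
      closure : ∃ λ X → Defined (insert (λ _ → nothing) b V′b) ⊆ Defined X × ParentClosed X
      closure = saturate ParentClosed grow-parentClosed (insert (λ _ → nothing) b V′b)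

    X : PartialSection
    X = proj₁ closure

    X-closed : ParentClosed X
    X-closed = proj₂ (proj₂ closure)

    b∈X : Defined X b
    b∈X = proj₁ (proj₂ closure) (insert-defined _ b V′b)

    L : ESet G
    L = ParentEdge X

    L? : Decidable L
    L? = parentEdge? X

    parentEdges-lowerBound : ∀ {P} (P-tree : IsSpanningTreeOf G V′ E′ P) →
                             count (defined? X ∖? a) ≤ count (ParentsIn.parentEdge? X P-tree)
    parentEdges-lowerBound P-tree = ParentsIn.parentEdges-lowerBound X P-tree (defined? X ∖? a)
      λ (d , z≢a) → z≢a , _ , cong (Maybe.map _) (proj₂ (defined⇒just X d))

    count-L-by-trees :
      count L? ≡ count (ParentsIn.parentEdge? X A-tree) + count (ParentsIn.parentEdge? X B-tree)
    count-L-by-trees = count-⊎ _ _ L? id id λ (_ , eq) (_ , eq′) →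
      proj₂ (proj₂ A⊎B) _ (proj₁ (ParentsIn.parent-step X A-tree eq))
                          (proj₁ (ParentsIn.parent-step X B-tree eq′))

    count-L-by-colours : count L? ≡ count (S? ∩? L?) + count (T? ∩? L?)
    count-L-by-colours = count-⊎ (S? ∩? L?) (T? ∩? L?) L?
      (λ {f} Lf → Sum.map (_, Lf) (_, Lf) (proj₁ S⊎T f tt)) [ proj₂ , proj₂ ]
      λ (Sf , _) (Tf , _) → proj₂ (proj₂ S⊎T) _ Sf Tf

    count-S∩L-upperBound : count (S? ∩? L?) ≤ count (defined? X ∖? a)
    count-S∩L-upperBound = TreeS.edges-upperBound (S? ∩? L?) (defined? X) proj₁ (X-closed ∘ proj₂) a

    module Reach = Saturation (Walk G (T ∩ L) a)

    SideClosed : Reach.PartialSection → Set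
    SideClosed R = ∀ {g} → (T ∩ L) g → is-just (R (end₁ g)) ≡ is-just (R (end₂ g))

    grow-sideClosed : ∀ R → SideClosed R ⊎ ∃ λ z → R z ≡ nothing × Walk G (T ∩ L) a z
    grow-sideClosed R
      with any? (λ g → (T? ∩? L?) g ×-dec ¬? (is-just (R (end₁ g)) Bool.≟ is-just (R (end₂ g))))
    ... | no none = inj₁ λ {g} TLg →
      decidable-stable (is-just (R (end₁ g)) Bool.≟ is-just (R (end₂ g))) (λ ≢ → none (g , TLg , ≢))
    ... | yes (g , TLg , sides≢) with R (end₁ g) in eq₁ | R (end₂ g) in eq₂
    ...   | just p  | nothing = inj₂ (end₂ g , eq₂ , p ++ʷ step g TLg (inj₁ refl) [])
    ...   | nothing | just p  = inj₂ (end₁ g , eq₁ , p ++ʷ step g TLg (inj₂ refl) [])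
    ...   | just _  | just _  = ⊥-elim (sides≢ refl)
    ...   | nothing | nothing = ⊥-elim (sides≢ refl)

    private opaque
      reach : ∃ λ R → Reach.Defined (Reach.insert (λ _ → nothing) a []) ⊆ Reach.Defined R × SideClosed R
      reach = Reach.saturate SideClosed grow-sideClosed (Reach.insert (λ _ → nothing) a [])

    R : Reach.PartialSection
    R = proj₁ reach

    a∈R : Reach.Defined R a
    a∈R = proj₁ (proj₂ reach) (Reach.insert-defined _ a [])

    count-T∩L-upperBound : ¬ Reach.Defined R b → count (T? ∩? L?) < count (defined? X ∖? a)
    count-T∩L-upperBound b∉R =
      subst (count (T? ∩? L?) <_) (sym (count-remove (defined? X ∖? a) (b∈X , b≢a)))
        (s≤s (TreeT.edges-upperBound-separated (T? ∩? L?) (defined? X) proj₁ (X-closed ∘ proj₂)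
                (is-just ∘ R) (proj₂ (proj₂ reach)) a∈R (cong is-just (Reach.undefined⇒nothing R b∉R))))
      where b≢a : b ≢ a
            b≢a refl = b∉R a∈R

    b∈R : Reach.Defined R b
    b∈R = decidable-stable (Reach.defined? R b) λ b∉R → <-irrefl refl (begin-strict
      count (defined? X ∖? a) + count (defined? X ∖? a)
        ≤⟨ +-mono-≤ (parentEdges-lowerBound A-tree) (parentEdges-lowerBound B-tree) ⟩
      count (ParentsIn.parentEdge? X A-tree) + count (ParentsIn.parentEdge? X B-tree)
        ≡⟨ count-L-by-trees ⟨
      count L?
        ≡⟨ count-L-by-colours ⟩
      count (S? ∩? L?) + count (T? ∩? L?)
        <⟨ +-mono-≤-< count-S∩L-upperBound (count-T∩L-upperBound b∉R) ⟩
      count (defined? X ∖? a) + count (defined? X ∖? a) ∎)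
      where open ≤-Reasoning

    T∩E′-connects : Walk G (T ∩ E′) a b
    T∩E′-connects with Reach.defined⇒just R b∈R
    ... | p , _ = mapʷ (Product.map₂ (parentEdge⊆E′ X)) p

  fundamentalCycle⊆T∩E′ : ∀ {e} → E′ e → CycleSubset G T e (λ f → (T f × E′ f) ⊎ f ≡ e)
  fundamentalCycle⊆T∩E′ {e} E′e = fundamentalCycle⊆path+edge (proj₁ (proj₂ T-tree)) proj₁
    (T∩E′-connects (proj₁ (subgraph e E′e)) (proj₂ (subgraph e E′e)))

disjointUnion-comm : ∀ {G E′ A B} → DisjointUnion G E′ A B → DisjointUnion G E′ B A
disjointUnion-comm (cover , within , disjoint) =
  (λ f → Sum.swap ∘ cover f) , (λ f → within f ∘ Sum.swap) , λ f Bf Af → disjoint f Af Bf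

bispanningSubgraph-claims : (G : Graph) {S T : ESet G} →
  IsSpanningTreeOf G (AllV G) (AllE G) S → IsSpanningTreeOf G (AllV G) (AllE G) T →
  DisjointUnion G (AllE G) S T → {V′ : VSet G} {E′ : ESet G} →
  IsSubgraph G V′ E′ → IsBispanning G V′ E′ → Claims G E′ S T
bispanningSubgraph-claims G {S} {T} S-tree T-tree S⊎T {E′ = E′} subgraph (_ , _ , A-tree , B-tree , A⊎B) =
  (λ _ _ → BispanningSubgraph.fundamentalCycle⊆T∩E′ G S-tree T-tree S⊎T subgraph A-tree B-tree A⊎B) ,
  fundamentalCut⊆T∖E′
  where
    open Walks G

    fundamentalCut⊆T∖E′ : ∀ e → S e → ¬ E′ e → CutSubset G S e (λ f → (T f × ¬ E′ f) ⊎ f ≡ e)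
    fundamentalCut⊆T∖E′ e Se ¬E′e f f∈cut with proj₁ S⊎T f tt
    ... | inj₁ Sf = inj₂ (cut∩tree (proj₁ (proj₂ S-tree)) Se f∈cut Sf)
    ... | inj₂ Tf = inj₁ (Tf , λ E′f → [ ¬E′e ∘ proj₂ , (λ e≡f → ¬Sf (subst S e≡f Se)) ]
            (cut-edge⇒on-cycle (proj₁ (proj₂ S-tree)) Se (proj₂ (proj₂ S-tree) _ _ tt tt) f∈cut ¬Sf
               (BispanningSubgraph.fundamentalCycle⊆T∩E′ G T-tree S-tree (disjointUnion-comm {G} S⊎T)
                  subgraph A-tree B-tree A⊎B E′f)))
      where ¬Sf : ¬ S f
            ¬Sf Sf = proj₂ (proj₂ S⊎T) f Sf Tf

mainTheorem11 : (G : Graph) (S T : ESet G) →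
    IsSpanningTreeOf G (AllV G) (AllE G) S →
    IsSpanningTreeOf G (AllV G) (AllE G) T →
    DisjointUnion G (AllE G) S T →
    (V' : VSet G) (E' : ESet G) →
    IsSubgraph G V' E' →
    IsBispanning G V' E' →
    Claims G E' S T × Claims G E' T S
mainTheorem11 G S T S-tree T-tree S⊎T V′ E′ subgraph bispanning =
  bispanningSubgraph-claims G S-tree T-tree S⊎T subgraph bispanning ,
  bispanningSubgraph-claims G T-tree S-tree (disjointUnion-comm {G} S⊎T) subgraph bispanning
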